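{- For every $n\in\mathbb N$ there exist infinitely many natural numbers each of which is antipalindromic in at least $n$ distinct bases.
   Context: For $b\in\mathbb N$, $b\ge2$, write a natural number $x$ in base $b$ as $x=a_tb^t+\dots+a_1b+a_0$ with digits $a_i\in\{0,1,\dots,b-1\}$ and $a_t\neq 0$. The number $x$ is called antipalindromic in base $b$ if $a_j=b-1-a_{t-j}$ for all $j\in\{0,1,\dots,t\}$. -}

module Defs where

open import Data.Nat using (ℕ; zero; suc; _+_; _∸_; _^_; _≤_; _<_; NonZero)
open import Data.Nat.DivMod using (_/_; _%_)
open import Data.Nat.Properties using (m^n≢0)
open import Data.Product using (Σ; _×_)
open import Data.Empty using (⊥)
open import Relation.Binary.PropositionalEquality using (_≡_)

digit : (b : ℕ) → .{{NonZero b}} → ℕ → ℕ → ℕ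
digit b x j = _/_ x (b ^ j) {{m^n≢0 b j}} % b

-- x is antipalindromic in base b (b ≥ 2 is required separately): with t
-- the index of the leading digit (b^t ≤ x < b^(t+1), so a_t ≠ 0 and x ≥ 1),
-- a_j = b - 1 - a_{t-j} for all j ∈ {0,…,t}.
-- (For b = 0 the predicate is defined as ⊥; it is only used with b ≥ 2.)
Antipalindromic : ℕ → ℕ → Set
Antipalindromic zero x = ⊥
Antipalindromic b@(suc _) x =
  Σ ℕ λ t → (b ^ t ≤ x) × (x < b ^ suc t) ×
    ((j : ℕ) → j ≤ t → digit b x j ≡ (b ∸ 1) ∸ digit b x (t ∸ j))

module Submission where

-- For 1 ≤ k ≤ b − 1 the number (k + 1)(b − 1) = k·b + (b − 1 − k) has the two
-- base-b digits k and b − 1 − k, so it is antipalindromic in base b. For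
-- N ≤ e < 2N the power 2^(2N) = 2^(2N−e) · 2^e is of this shape with
-- b = 2^e + 1 and k + 1 = 2^(2N−e), giving N distinct bases for 2^(2N); and N
-- can be taken as large as we like.

open import Defs
open import Data.Nat using (ℕ; _≤_; _<_)
open import Data.List using (List; length)
open import Data.List.Relation.Unary.All using (All)
open import Data.List.Relation.Unary.Unique.Propositional using (Unique)
open import Data.Product using (Σ; _×_)

open import Data.Nat using (zero; suc; _+_; _*_; _∸_; _^_; z≤n; s≤s; NonZero)
open import Data.Nat.Properties
open import Data.Nat.DivMod
open import Data.Nat.Divisibility using (divides-refl)
open import Data.List using (applyUpTo)
open import Data.List.Properties using (length-applyUpTo)
import Data.List.Relation.Unary.All.Properties as All
import Data.List.Relation.Unary.Unique.Propositional.Properties as Unique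
open import Data.Product using (_,_)
open import Relation.Binary.PropositionalEquality

digit-0 : ∀ b .{{_ : NonZero b}} x → digit b x 0 ≡ x % b
digit-0 b x = %-congˡ (n/1≡n x)

digit-1 : ∀ b .{{_ : NonZero b}} x → digit b x 1 ≡ x / b % b
digit-1 b x = %-congˡ (/-congʳ {{m^n≢0 b 1}} (*-identityʳ b))

module _ {b r : ℕ} .{{_ : NonZero b}} (r<b : r < b) (q : ℕ) where

  [r+qb]%b≡r : (r + q * b) % b ≡ r
  [r+qb]%b≡r = trans ([m+kn]%n≡m%n r q b) (m<n⇒m%n≡m r<b)

  [r+qb]/b≡q : (r + q * b) / b ≡ q
  [r+qb]/b≡q = begin
    (r + q * b) / b     ≡⟨ +-distrib-/-∣ʳ r (divides-refl q) ⟩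
    r / b + q * b / b   ≡⟨ cong₂ _+_ (m<n⇒m/n≡0 r<b) (m*n/n≡m q b) ⟩
    q                   ∎
    where open ≡-Reasoning

antipalindromic-twoDigit : ∀ {c q r} → 1 ≤ q → q + r ≡ c →
                           Antipalindromic (suc c) (r + q * suc c)
antipalindromic-twoDigit {c} {q} {r} 1≤q q+r≡c = 1 , lower , upper , digits
  where
  b = suc c

  r<b : r < b
  r<b = s≤s (subst (r ≤_) q+r≡c (m≤n+m r q))

  q<b : q < b
  q<b = s≤s (subst (q ≤_) q+r≡c (m≤m+n q r))

  lower : b ^ 1 ≤ r + q * b
  lower = ≤-trans (≤-reflexive (*-comm b 1))
                  (≤-trans (*-monoˡ-≤ b 1≤q) (m≤n+m (q * b) r))

  upper : r + q * b < b ^ 2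
  upper = ≤-trans (+-monoˡ-≤ (q * b) r<b)
                  (≤-trans (*-monoˡ-≤ b q<b) (≤-reflexive (cong (b *_) (sym (*-identityʳ b)))))

  digit0 : digit b (r + q * b) 0 ≡ r
  digit0 = trans (digit-0 b (r + q * b)) ([r+qb]%b≡r r<b q)

  digit1 : digit b (r + q * b) 1 ≡ q
  digit1 = trans (digit-1 b (r + q * b)) (trans (%-congˡ ([r+qb]/b≡q r<b q)) (m<n⇒m%n≡m q<b))

  digits : ∀ j → j ≤ 1 → digit b (r + q * b) j ≡ c ∸ digit b (r + q * b) (1 ∸ j)
  digits zero    _ = begin
    digit b (r + q * b) 0   ≡⟨ digit0 ⟩
    r                       ≡⟨ sym (m+n∸m≡n q r) ⟩
    q + r ∸ q               ≡⟨ cong₂ _∸_ q+r≡c (sym digit1) ⟩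
    c ∸ digit b (r + q * b) 1 ∎
    where open ≡-Reasoning
  digits (suc zero) _ = begin
    digit b (r + q * b) 1   ≡⟨ digit1 ⟩
    q                       ≡⟨ sym (m+n∸n≡m q r) ⟩
    q + r ∸ r               ≡⟨ cong₂ _∸_ q+r≡c (sym digit0) ⟩
    c ∸ digit b (r + q * b) 0 ∎
    where open ≡-Reasoning
  digits (suc (suc _)) (s≤s ())

antipalindromic-*-predBase : ∀ {k c} → 2 ≤ k → k ≤ suc c → Antipalindromic (suc c) (k * c)
antipalindromic-*-predBase {suc q} {c} (s≤s 1≤q) (s≤s q≤c) =
  subst (Antipalindromic (suc c)) (sym [1+q]*c≡[c∸q]+q*[1+c])
        (antipalindromic-twoDigit 1≤q (m+[n∸m]≡n q≤c))
  where
  open ≡-Reasoning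
  [1+q]*c≡[c∸q]+q*[1+c] : suc q * c ≡ (c ∸ q) + q * suc c
  [1+q]*c≡[c∸q]+q*[1+c] = begin
    c + q * c             ≡⟨ cong (_+ q * c) (sym (m∸n+n≡m q≤c)) ⟩
    (c ∸ q) + q + q * c   ≡⟨ +-assoc (c ∸ q) q (q * c) ⟩
    (c ∸ q) + (q + q * c) ≡⟨ cong ((c ∸ q) +_) (sym (*-suc q c)) ⟩
    (c ∸ q) + q * suc c   ∎

antipalindromic-2^T : ∀ {e T} → e < T → T ≤ e + e → Antipalindromic (suc (2 ^ e)) (2 ^ T)
antipalindromic-2^T {e} {T} e<T T≤e+e =
  subst (Antipalindromic (suc (2 ^ e))) 2^d*2^e≡2^T
        (antipalindromic-*-predBase 2≤2^d (m≤n⇒m≤1+n 2^d≤2^e))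
  where
  d = T ∸ e

  2^d*2^e≡2^T : 2 ^ d * 2 ^ e ≡ 2 ^ T
  2^d*2^e≡2^T = trans (sym (^-distribˡ-+-* 2 d e)) (cong (2 ^_) (m∸n+n≡m (<⇒≤ e<T)))

  2≤2^d : 2 ≤ 2 ^ d
  2≤2^d = ^-monoʳ-≤ 2 (m<n⇒0<n∸m e<T)

  2^d≤2^e : 2 ^ d ≤ 2 ^ e
  2^d≤2^e = ^-monoʳ-≤ 2 (m≤n+o⇒m∸n≤o T e T≤e+e)

n<2^n : ∀ n → n < 2 ^ n
n<2^n zero    = s≤s z≤n
n<2^n (suc n) = begin-strict
  suc n             ≤⟨ n<2^n n ⟩
  2 ^ n             <⟨ m<m+n (2 ^ n) (m^n>0 2 n) ⟩
  2 ^ n + 2 ^ n     ≡⟨ cong (2 ^ n +_) (sym (+-identityʳ (2 ^ n))) ⟩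
  2 ^ suc n         ∎
  where open ≤-Reasoning

powerBases : ℕ → List ℕ
powerBases N = applyUpTo (λ i → suc (2 ^ (N + i))) N

length-powerBases : ∀ N → length (powerBases N) ≡ N
length-powerBases N = length-applyUpTo _ N

powerBases-unique : ∀ N → Unique (powerBases N)
powerBases-unique N = Unique.applyUpTo⁺₁ _ N λ i<j _ →
  <⇒≢ (s≤s (^-monoʳ-< 2 (s≤s (s≤s z≤n)) (+-monoʳ-< N i<j)))

powerBases-antipalindromic : ∀ N →
  All (λ b → (2 ≤ b) × Antipalindromic b (2 ^ (N + N))) (powerBases N)
powerBases-antipalindromic N = All.applyUpTo⁺₁ _ N λ {i} i<N →
  s≤s (m^n>0 2 (N + i)) ,
  antipalindromic-2^T (+-monoʳ-< N i<N) (+-mono-≤ (m≤m+n N i) (m≤m+n N i))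

mainTheorem14 : (n : ℕ) → (m : ℕ) →
    Σ ℕ λ x → (m < x) ×
    (Σ (List ℕ) λ bs → (n ≤ length bs) × Unique bs ×
    All (λ b → (2 ≤ b) × Antipalindromic b x) bs)
mainTheorem14 n m =
  2 ^ (N + N) , m<2^[N+N] ,
  powerBases N , n≤N , powerBases-unique N , powerBases-antipalindromic N
  where
  N = n + m

  m<2^[N+N] : m < 2 ^ (N + N)
  m<2^[N+N] = ≤-<-trans (≤-trans (m≤n+m m n) (m≤m+n N N)) (n<2^n (N + N))

  n≤N : n ≤ length (powerBases N)
  n≤N = subst (n ≤_) (sym (length-powerBases N)) (m≤m+n n m)
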